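{- For every $n\ge 0$, $$U_n(x,s,q)=\sum_{k=0}^{\lfloor n/2\rfloor}q^{k^2}\begin{bmatrix} n-k\\ k\end{bmatrix}(1+q^{k+1})(1+q^{k+2})\cdots(1+q^{n-k})\,s^kx^{n-2k}.$$
   Context: Let $q$ be a real number with $q\neq -1$. Let $[m]=1+q+\dots+q^{m-1}$, $[m]!=[1]\cdots[m]$, and $\begin{bmatrix} m\\ j\end{bmatrix}=\frac{[m]!}{[j]![m-j]!}$ for $0\le j\le m$. The $q$-Chebyshev polynomials of the second kind are defined by $U_{ -1}(x,s,q)=0$, $U_0(x,s,q)=1$ and $U_n(x,s,q)=(1+q^{n})xU_{n-1}(x,s,q)+q^{n-1}sU_{n-2}(x,s,q)$ for $n\ge 1$. An empty product equals $1$.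
   Formalization: The parameter q is a rational number with $q\neq -1$ rather than a real one, and the variables x and s are rational as well. -}

module Defs where

open import Data.Nat as ℕ using (ℕ; zero; suc; _∸_; ⌊_/2⌋)
open import Data.Rational using (ℚ; 0ℚ; 1ℚ; _+_; _*_; _÷_; ≢-nonZero)
open import Data.Rational.Properties using (_≟_)
open import Relation.Nullary using (yes; no)

_^_ : ℚ → ℕ → ℚ
q ^ zero  = 1ℚ
q ^ suc m = q * (q ^ m)

-- total division: x ÷' y = x ÷ y when y ≠ 0 (and 0 otherwise; never used
-- in the statement since all denominators are nonzero when q ≠ -1)
_÷'_ : ℚ → ℚ → ℚ
x ÷' y with y ≟ 0ℚ
... | yes _  = 0ℚ
... | no y≢0 = _÷_ x y {{≢-nonZero y≢0}}

sumTo : ℕ → (ℕ → ℚ) → ℚ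
sumTo zero    f = 0ℚ
sumTo (suc n) f = sumTo n f + f n

prodTo : ℕ → (ℕ → ℚ) → ℚ
prodTo zero    f = 1ℚ
prodTo (suc n) f = prodTo n f * f n

qint : ℚ → ℕ → ℚ
qint q m = sumTo m (λ i → q ^ i)

qfact : ℚ → ℕ → ℚ
qfact q m = prodTo m (λ i → qint q (suc i))

-- q-binomial [m choose j] = [m]! / ([j]! [m-j]!)   (used for 0 ≤ j ≤ m)
qbinom : ℚ → ℕ → ℕ → ℚ
qbinom q m j = qfact q m ÷' (qfact q j * qfact q (m ∸ j))

U : ℕ → ℚ → ℚ → ℚ → ℚ
U zero          x s q = 1ℚ
U (suc zero)    x s q = (1ℚ + q ^ 1) * x * U zero x s q
U (suc (suc n)) x s q =
  (1ℚ + q ^ suc (suc n)) * x * U (suc n) x s q + (q ^ suc n) * s * U n x s q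

-- (1+q^(a+1))(1+q^(a+2))...(1+q^b)  (empty product = 1 when b ≤ a)
prodRange : ℚ → ℕ → ℕ → ℚ
prodRange q a b = prodTo (b ∸ a) (λ i → 1ℚ + q ^ (a ℕ.+ suc i))

rhs : ℕ → ℚ → ℚ → ℚ → ℚ
rhs n x s q = sumTo (suc ⌊ n /2⌋) (λ k →
  (q ^ (k ℕ.* k)) * qbinom q (n ∸ k) k * prodRange q k (n ∸ k)
    * (s ^ k) * (x ^ (n ∸ (2 ℕ.* k))))

-- Let gauss k j be the Gaussian binomial [k+j choose k], defined by Pascal's rule
-- alone; a double induction gives the dual Pascal rule as well, and since q ≠ -1
-- makes every [m] nonzero, qbinom agrees with it. Put the summand with s^k x^j
-- into an array entry k j, so that the right-hand side for n is the sum of the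
-- antidiagonal 2k + j = n. Combining the two Pascal rules shows that the array
-- satisfies the local recurrence
--   entry (k+1) (j+1) = α · entry (k+1) j + β · entry k (j+1)
-- with the coefficients α, β of the recurrence of U at n = 2k+j+1, and summing it
-- along antidiagonals gives the recurrence of U.
module Submission where

open import Defs
open import Data.Nat.Base as ℕ using (ℕ; zero; suc; _∸_; ⌊_/2⌋; z≤n; s≤s)
import Data.Nat.Properties as ℕ
import Data.Nat.Tactic.RingSolver as ℕ-Solver
open import Data.Rational.Base
  using (ℚ; -_; 0ℚ; 1ℚ; _+_; _*_; _-_; 1/_; _≤_; ∣_∣; NonZero; NonNegative; ≢-nonZero)
open import Data.Rational.Properties
open import Data.Sum.Base using (_⊎_; inj₁; inj₂)
open import Data.Empty using (⊥; ⊥-elim)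
open import Level using (0ℓ)
open import Relation.Binary.PropositionalEquality
open import Relation.Nullary using (yes; no)
open import Relation.Nullary.Decidable.Core using (dec⇒maybe)
open import Algebra.Properties.Group +-0-group using (x∙y⁻¹≈ε⇒x≈y)
open import Tactic.RingSolver using (solve-∀)
open import Tactic.RingSolver.Core.AlmostCommutativeRing
  using (AlmostCommutativeRing; fromCommutativeRing)

open ≡-Reasoning

ℚ-ring : AlmostCommutativeRing 0ℓ 0ℓ
ℚ-ring = fromCommutativeRing +-*-commutativeRing (λ x → dec⇒maybe (0ℚ ≟ x))

^-+ : ∀ p m n → p ^ (m ℕ.+ n) ≡ p ^ m * p ^ n
^-+ p zero    n = sym (*-identityˡ (p ^ n))
^-+ p (suc m) n = trans (cong (p *_) (^-+ p m n)) (sym (*-assoc p (p ^ m) (p ^ n)))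

^-*2 : ∀ p k → p ^ (k ℕ.* 2) ≡ p ^ k * p ^ k
^-*2 p k = trans (cong (p ^_) (k*2≡k+k k)) (^-+ p k k)
  where
  k*2≡k+k : ∀ k → k ℕ.* 2 ≡ k ℕ.+ k
  k*2≡k+k = ℕ-Solver.solve-∀

^-*2+ : ∀ p k j → p ^ (k ℕ.* 2 ℕ.+ j) ≡ p ^ k * p ^ k * p ^ j
^-*2+ p k j = trans (^-+ p (k ℕ.* 2) j) (cong (_* p ^ j) (^-*2 p k))

^-suc-square : ∀ p k → p ^ (suc k ℕ.* suc k) ≡ p ^ (k ℕ.* k) * (p * (p ^ k * p ^ k))
^-suc-square p k = begin
  p ^ (suc k ℕ.* suc k)                  ≡⟨ cong (p ^_) (square k) ⟩
  p ^ (k ℕ.* k ℕ.+ suc (k ℕ.* 2))        ≡⟨ ^-+ p (k ℕ.* k) (suc (k ℕ.* 2)) ⟩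
  p ^ (k ℕ.* k) * (p * p ^ (k ℕ.* 2))    ≡⟨ cong (λ r → p ^ (k ℕ.* k) * (p * r)) (^-*2 p k) ⟩
  p ^ (k ℕ.* k) * (p * (p ^ k * p ^ k))  ∎
  where
  square : ∀ k → suc k ℕ.* suc k ≡ k ℕ.* k ℕ.+ suc (k ℕ.* 2)
  square = ℕ-Solver.solve-∀

∣p^n∣≡∣p∣^n : ∀ p n → ∣ p ^ n ∣ ≡ ∣ p ∣ ^ n
∣p^n∣≡∣p∣^n p zero    = refl
∣p^n∣≡∣p∣^n p (suc n) = trans (∣p*q∣≡∣p∣*∣q∣ p (p ^ n)) (cong (∣ p ∣ *_) (∣p^n∣≡∣p∣^n p n))

^-nonNeg : ∀ p .{{_ : NonNegative p}} n → NonNegative (p ^ n)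
^-nonNeg p zero    = _
^-nonNeg p (suc n) = nonNeg*nonNeg⇒nonNeg p (p ^ n) {{^-nonNeg p n}}

x*y≡0⇒x≡0 : ∀ {x y} → y ≢ 0ℚ → x * y ≡ 0ℚ → x ≡ 0ℚ
x*y≡0⇒x≡0 {x} {y} y≢0 xy≡0 = begin
  x                ≡⟨ sym (*-identityʳ x) ⟩
  x * 1ℚ           ≡⟨ cong (x *_) (sym (*-inverseʳ y)) ⟩
  x * (y * 1/ y)   ≡⟨ sym (*-assoc x y (1/ y)) ⟩
  x * y * 1/ y     ≡⟨ cong (_* 1/ y) xy≡0 ⟩
  0ℚ * 1/ y        ≡⟨ *-zeroˡ (1/ y) ⟩
  0ℚ               ∎
  where instance y-nonZero : NonZero y
                 y-nonZero = ≢-nonZero y≢0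

*-≢0 : ∀ {x y} → x ≢ 0ℚ → y ≢ 0ℚ → x * y ≢ 0ℚ
*-≢0 x≢0 y≢0 xy≡0 = x≢0 (x*y≡0⇒x≡0 y≢0 xy≡0)

1≤x⇒x≢0 : ∀ {x} → 1ℚ ≤ x → x ≢ 0ℚ
1≤x⇒x≢0 1≤x = ≢-sym (<⇒≢ (<-≤-trans (positive⁻¹ 1ℚ) 1≤x))

*-÷'-cancelʳ : ∀ b d → d ≢ 0ℚ → (b * d) ÷' d ≡ b
*-÷'-cancelʳ b d d≢0 with d ≟ 0ℚ
... | yes d≡0 = ⊥-elim (d≢0 d≡0)
... | no  _   = begin
  b * d * 1/ d    ≡⟨ *-assoc b d (1/ d) ⟩
  b * (d * 1/ d)  ≡⟨ cong (b *_) (*-inverseʳ d) ⟩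
  b * 1ℚ          ≡⟨ *-identityʳ b ⟩
  b               ∎
  where instance d-nonZero : NonZero d
                 d-nonZero = ≢-nonZero d≢0

sumTo-suc : ∀ n (f : ℕ → ℚ) → sumTo (suc n) f ≡ f 0 + sumTo n (λ k → f (suc k))
sumTo-suc zero    f = +-comm 0ℚ (f 0)
sumTo-suc (suc n) f = begin
  sumTo (suc n) f + f (suc n)                          ≡⟨ cong (_+ f (suc n)) (sumTo-suc n f) ⟩
  f 0 + sumTo n (λ k → f (suc k)) + f (suc n)          ≡⟨ +-assoc (f 0) _ (f (suc n)) ⟩
  f 0 + (sumTo n (λ k → f (suc k)) + f (suc n))        ∎

sumTo-zero : ∀ n (f : ℕ → ℚ) → (∀ k → f k ≡ 0ℚ) → sumTo n f ≡ 0ℚ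
sumTo-zero zero    f f≡0 = refl
sumTo-zero (suc n) f f≡0 = cong₂ _+_ (sumTo-zero n f f≡0) (f≡0 n)

sumTo-linear : ∀ n a b (f g : ℕ → ℚ) →
               sumTo n (λ k → a * f k + b * g k) ≡ a * sumTo n f + b * sumTo n g
sumTo-linear zero    a b f g = sym (cong₂ _+_ (*-zeroʳ a) (*-zeroʳ b))
sumTo-linear (suc n) a b f g = begin
  sumTo n (λ k → a * f k + b * g k) + (a * f n + b * g n)
    ≡⟨ cong (_+ (a * f n + b * g n)) (sumTo-linear n a b f g) ⟩
  a * sumTo n f + b * sumTo n g + (a * f n + b * g n)
    ≡⟨ regroup a b (sumTo n f) (sumTo n g) (f n) (g n) ⟩
  a * (sumTo n f + f n) + b * (sumTo n g + g n)
    ∎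
  where
  regroup : ∀ a b F G x y → a * F + b * G + (a * x + b * y) ≡ a * (F + x) + b * (G + y)
  regroup = solve-∀ ℚ-ring

sumTo-cong : ∀ n {f g : ℕ → ℚ} → (∀ k → k ℕ.< n → f k ≡ g k) → sumTo n f ≡ sumTo n g
sumTo-cong zero    f≡g = refl
sumTo-cong (suc n) f≡g =
  cong₂ _+_ (sumTo-cong n (λ k k<n → f≡g k (ℕ.m<n⇒m<1+n k<n))) (f≡g n (ℕ.n<1+n n))

prodTo-suc : ∀ n (f : ℕ → ℚ) → prodTo (suc n) f ≡ f 0 * prodTo n (λ k → f (suc k))
prodTo-suc zero    f = *-comm 1ℚ (f 0)
prodTo-suc (suc n) f = begin
  prodTo (suc n) f * f (suc n)                         ≡⟨ cong (_* f (suc n)) (prodTo-suc n f) ⟩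
  f 0 * prodTo n (λ k → f (suc k)) * f (suc n)         ≡⟨ *-assoc (f 0) _ (f (suc n)) ⟩
  f 0 * (prodTo n (λ k → f (suc k)) * f (suc n))       ∎

prodTo-cong : ∀ n {f g : ℕ → ℚ} → (∀ k → f k ≡ g k) → prodTo n f ≡ prodTo n g
prodTo-cong zero    f≡g = refl
prodTo-cong (suc n) f≡g = cong₂ _*_ (prodTo-cong n f≡g) (f≡g n)

geometric-sum : ∀ q n → (1ℚ - q) * qint q n ≡ 1ℚ - q ^ n
geometric-sum q zero    = *-zeroʳ (1ℚ - q)
geometric-sum q (suc n) = begin
  (1ℚ - q) * (qint q n + q ^ n)               ≡⟨ expand q (qint q n) (q ^ n) ⟩
  (1ℚ - q) * qint q n + (q ^ n - q * q ^ n)   ≡⟨ cong (_+ (q ^ n - q * q ^ n)) (geometric-sum q n) ⟩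
  1ℚ - q ^ n + (q ^ n - q * q ^ n)            ≡⟨ telescope (q ^ n) (q * q ^ n) ⟩
  1ℚ - q * q ^ n                              ∎
  where
  expand : ∀ q S P → (1ℚ - q) * (S + P) ≡ (1ℚ - q) * S + (P - q * P)
  expand = solve-∀ ℚ-ring
  telescope : ∀ P P′ → 1ℚ - P + (P - P′) ≡ 1ℚ - P′
  telescope = solve-∀ ℚ-ring

qint-+ : ∀ q m n → qint q (m ℕ.+ n) ≡ qint q m + q ^ m * qint q n
qint-+ q m zero = begin
  qint q (m ℕ.+ 0)          ≡⟨ cong (qint q) (ℕ.+-identityʳ m) ⟩
  qint q m                  ≡⟨ sym (+-identityʳ (qint q m)) ⟩
  qint q m + 0ℚ             ≡⟨ cong (qint q m +_) (sym (*-zeroʳ (q ^ m))) ⟩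
  qint q m + q ^ m * 0ℚ     ∎
qint-+ q m (suc n) = begin
  qint q (m ℕ.+ suc n)                          ≡⟨ cong (qint q) (ℕ.+-suc m n) ⟩
  qint q (m ℕ.+ n) + q ^ (m ℕ.+ n)              ≡⟨ cong₂ _+_ (qint-+ q m n) (^-+ q m n) ⟩
  qint q m + q ^ m * qint q n + q ^ m * q ^ n   ≡⟨ +-assoc (qint q m) _ _ ⟩
  qint q m + (q ^ m * qint q n + q ^ m * q ^ n) ≡⟨ cong (qint q m +_) (sym (*-distribˡ-+ (q ^ m) _ _)) ⟩
  qint q m + q ^ m * (qint q n + q ^ n)         ∎

qint-≥1 : ∀ q .{{_ : NonNegative q}} n → 1ℚ ≤ qint q (suc n)
qint-≥1 q zero    = ≤-refl
qint-≥1 q (suc n) = +-mono-≤ (qint-≥1 q n) (nonNegative⁻¹ (q ^ suc n) {{^-nonNeg q (suc n)}})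

-- For p ≥ 0, (1 - p) [m+1] = 1 - p^(m+1) = 0 with [m+1] ≥ 1.
^-suc≡1⇒≡1 : ∀ p .{{_ : NonNegative p}} m → p ^ suc m ≡ 1ℚ → p ≡ 1ℚ
^-suc≡1⇒≡1 p m p^[m+1]≡1 = sym (x∙y⁻¹≈ε⇒x≈y 1ℚ p 1-p≡0)
  where
  1-p≡0 : 1ℚ - p ≡ 0ℚ
  1-p≡0 = x*y≡0⇒x≡0 (1≤x⇒x≢0 (qint-≥1 p m))
            (trans (geometric-sum p (suc m)) (cong (λ p′ → 1ℚ - p′) p^[m+1]≡1))

-- [n+1] = 0 forces q^(n+1) = 1, hence ∣q∣ = 1; q = 1 is excluded since [n+1] ≥ 1 there.
qint-≢0 : ∀ q → q ≢ - 1ℚ → ∀ n → qint q (suc n) ≢ 0ℚ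
qint-≢0 q q≢-1 n [n+1]≡0 = q≢±1 (∣p∣≡p∨∣p∣≡-p q)
  where
  q^[n+1]≡1 : q ^ suc n ≡ 1ℚ
  q^[n+1]≡1 = sym (x∙y⁻¹≈ε⇒x≈y 1ℚ (q ^ suc n)
    (trans (sym (geometric-sum q (suc n))) (trans (cong ((1ℚ - q) *_) [n+1]≡0) (*-zeroʳ (1ℚ - q)))))
  ∣q∣≡1 : ∣ q ∣ ≡ 1ℚ
  ∣q∣≡1 = ^-suc≡1⇒≡1 ∣ q ∣ {{∣-∣-nonNeg q}} n
            (trans (sym (∣p^n∣≡∣p∣^n q (suc n))) (cong ∣_∣ q^[n+1]≡1))
  q≢±1 : ∣ q ∣ ≡ q ⊎ ∣ q ∣ ≡ - q → ⊥
  q≢±1 (inj₁ ∣q∣≡q)  = 1≤x⇒x≢0 (qint-≥1 1ℚ n)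
    (subst (λ p → qint p (suc n) ≡ 0ℚ) (trans (sym ∣q∣≡q) ∣q∣≡1) [n+1]≡0)
  q≢±1 (inj₂ ∣q∣≡-q) = q≢-1 (neg-injective (trans (sym ∣q∣≡-q) ∣q∣≡1))

qfact-≢0 : ∀ q → q ≢ - 1ℚ → ∀ n → qfact q n ≢ 0ℚ
qfact-≢0 q q≢-1 zero    = 1≢0
qfact-≢0 q q≢-1 (suc n) = *-≢0 (qfact-≢0 q q≢-1 n) (qint-≢0 q q≢-1 n)

module _ (q : ℚ) where

  gauss : ℕ → ℕ → ℚ
  gauss zero    j       = 1ℚ
  gauss (suc k) zero    = 1ℚ
  gauss (suc k) (suc j) = q ^ suc k * gauss (suc k) j + gauss k (suc j)

  gauss-zeroʳ : ∀ k → gauss k 0 ≡ 1ℚ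
  gauss-zeroʳ zero    = refl
  gauss-zeroʳ (suc k) = refl

  gauss-pascal′ : ∀ k j → gauss (suc k) (suc j) ≡ gauss (suc k) j + q ^ suc j * gauss k (suc j)
  gauss-pascal′ zero zero = +-comm (q * 1ℚ * 1ℚ) 1ℚ
  gauss-pascal′ zero (suc j) = begin
    q * 1ℚ * gauss 1 (suc j) + 1ℚ
      ≡⟨ cong (λ g → q * 1ℚ * g + 1ℚ) (gauss-pascal′ zero j) ⟩
    q * 1ℚ * (gauss 1 j + q ^ suc j * 1ℚ) + 1ℚ
      ≡⟨ regroup q (gauss 1 j) (q ^ suc j) ⟩
    q * 1ℚ * gauss 1 j + 1ℚ + q * q ^ suc j * 1ℚ
      ∎
    where
    regroup : ∀ q g w → q * 1ℚ * (g + w * 1ℚ) + 1ℚ ≡ q * 1ℚ * g + 1ℚ + q * w * 1ℚ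
    regroup = solve-∀ ℚ-ring
  gauss-pascal′ (suc k) zero = begin
    q ^ suc (suc k) * 1ℚ + gauss (suc k) 1
      ≡⟨ cong (q ^ suc (suc k) * 1ℚ +_) (gauss-pascal′ k zero) ⟩
    q * q ^ suc k * 1ℚ + (1ℚ + q * 1ℚ * gauss k 1)
      ≡⟨ regroup q (q ^ suc k) (gauss k 1) ⟩
    1ℚ + q * 1ℚ * (q ^ suc k * 1ℚ + gauss k 1)
      ∎
    where
    regroup : ∀ q w g → q * w * 1ℚ + (1ℚ + q * 1ℚ * g) ≡ 1ℚ + q * 1ℚ * (w * 1ℚ + g)
    regroup = solve-∀ ℚ-ring
  gauss-pascal′ (suc k) (suc j) = begin
    q ^ suc (suc k) * gauss (suc (suc k)) (suc j) + gauss (suc k) (suc (suc j))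
      ≡⟨ cong₂ (λ A B → q ^ suc (suc k) * A + B) (gauss-pascal′ (suc k) j) (gauss-pascal′ k (suc j)) ⟩
    q * q ^ suc k * (g₂₀ + q ^ suc j * g₁₁) + (g₁₁ + q * q ^ suc j * g₀₂)
      ≡⟨ regroup q (q ^ suc k) (q ^ suc j) g₂₀ g₁₁ g₀₂ ⟩
    q * q ^ suc k * g₂₀ + g₁₁ + q * q ^ suc j * (q ^ suc k * g₁₁ + g₀₂)
      ∎
    where
    g₂₀ = gauss (suc (suc k)) j
    g₁₁ = gauss (suc k) (suc j)
    g₀₂ = gauss k (suc (suc j))
    regroup : ∀ q u v A B C → q * u * (A + v * B) + (B + q * v * C) ≡ q * u * A + B + q * v * (u * B + C)
    regroup = solve-∀ ℚ-ring

  gauss-mixed : ∀ k j →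
    (1ℚ + q ^ suc k * q ^ suc j) * gauss (suc k) (suc j) ≡
    (1ℚ + q ^ suc k * q ^ suc k * q ^ suc j) * gauss (suc k) j + q ^ suc j * (1ℚ + q ^ suc k) * gauss k (suc j)
  gauss-mixed k j = begin
    (1ℚ + u * v) * g₁₁                              ≡⟨ split u v g₁₁ ⟩
    g₁₁ + u * v * g₁₁                               ≡⟨ cong (_+ u * v * g₁₁) (gauss-pascal′ k j) ⟩
    g₁₀ + v * g₀₁ + u * v * (u * g₁₀ + g₀₁)         ≡⟨ collect u v g₁₀ g₀₁ ⟩
    (1ℚ + u * u * v) * g₁₀ + v * (1ℚ + u) * g₀₁    ∎
    where
    u = q ^ suc k
    v = q ^ suc j
    g₁₁ = gauss (suc k) (suc j)
    g₁₀ = gauss (suc k) j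
    g₀₁ = gauss k (suc j)
    split : ∀ u v g → (1ℚ + u * v) * g ≡ g + u * v * g
    split = solve-∀ ℚ-ring
    collect : ∀ u v a b → a + v * b + u * v * (u * a + b) ≡ (1ℚ + u * u * v) * a + v * (1ℚ + u) * b
    collect = solve-∀ ℚ-ring

  qfact-+ : ∀ k j → qfact q (k ℕ.+ j) ≡ gauss k j * qfact q k * qfact q j
  qfact-+ zero    j       = sym (*-identityˡ (qfact q j))
  qfact-+ (suc k) zero    = begin
    qfact q (suc k ℕ.+ 0)         ≡⟨ cong (qfact q) (ℕ.+-identityʳ (suc k)) ⟩
    qfact q (suc k)               ≡⟨ sym (*-identityʳ (qfact q (suc k))) ⟩
    qfact q (suc k) * 1ℚ          ≡⟨ cong (_* 1ℚ) (sym (*-identityˡ (qfact q (suc k)))) ⟩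
    1ℚ * qfact q (suc k) * 1ℚ     ∎
  qfact-+ (suc k) (suc j) = begin
    M * qint q (suc k ℕ.+ suc j)
      ≡⟨ cong (M *_) (qint-+ q (suc k) (suc j)) ⟩
    M * (ik + u * ij)
      ≡⟨ *-distribˡ-+ M ik (u * ij) ⟩
    M * ik + M * (u * ij)
      ≡⟨ cong₂ (λ A B → A * ik + B * (u * ij)) (qfact-+ k (suc j))
               (trans (cong (qfact q) (ℕ.+-suc k j)) (qfact-+ (suc k) j)) ⟩
    g₀₁ * F k * (F j * ij) * ik + g₁₀ * (F k * ik) * F j * (u * ij)
      ≡⟨ collect g₀₁ g₁₀ u (F k) (F j) ik ij ⟩
    (u * g₁₀ + g₀₁) * (F k * ik) * (F j * ij)
      ∎
    where
    F = qfact q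
    M = qfact q (k ℕ.+ suc j)
    u = q ^ suc k
    ik = qint q (suc k)
    ij = qint q (suc j)
    g₁₀ = gauss (suc k) j
    g₀₁ = gauss k (suc j)
    collect : ∀ g₀₁ g₁₀ u Fk Fj ik ij →
      g₀₁ * Fk * (Fj * ij) * ik + g₁₀ * (Fk * ik) * Fj * (u * ij) ≡ (u * g₁₀ + g₀₁) * (Fk * ik) * (Fj * ij)
    collect = solve-∀ ℚ-ring

  qbinom≡gauss : q ≢ - 1ℚ → ∀ k j → qbinom q (k ℕ.+ j) k ≡ gauss k j
  qbinom≡gauss q≢-1 k j = begin
    qfact q (k ℕ.+ j) ÷' (qfact q k * qfact q (k ℕ.+ j ∸ k))
      ≡⟨ cong₂ _÷'_ (qfact-+ k j) (cong (λ m → qfact q k * qfact q m) (ℕ.m+n∸m≡n k j)) ⟩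
    (gauss k j * qfact q k * qfact q j) ÷' (qfact q k * qfact q j)
      ≡⟨ cong (_÷' (qfact q k * qfact q j)) (*-assoc (gauss k j) (qfact q k) (qfact q j)) ⟩
    (gauss k j * (qfact q k * qfact q j)) ÷' (qfact q k * qfact q j)
      ≡⟨ *-÷'-cancelʳ (gauss k j) _ (*-≢0 (qfact-≢0 q q≢-1 k) (qfact-≢0 q q≢-1 j)) ⟩
    gauss k j
      ∎

-- antidiagonal f n k = f k (n - 2k), and 0 when 2k > n.
antidiagonal : (ℕ → ℕ → ℚ) → ℕ → ℕ → ℚ
antidiagonal f n             zero    = f 0 n
antidiagonal f zero          (suc k) = 0ℚ
antidiagonal f (suc zero)    (suc k) = 0ℚ
antidiagonal f (suc (suc n)) (suc k) = antidiagonal (λ k′ → f (suc k′)) n k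

antidiagonal-*2+ : ∀ f k j → antidiagonal f (k ℕ.* 2 ℕ.+ j) k ≡ f k j
antidiagonal-*2+ f zero    j = refl
antidiagonal-*2+ f (suc k) j = antidiagonal-*2+ (λ k′ → f (suc k′)) k j

k≤⌊n/2⌋⇒k*2≤n : ∀ n k → k ℕ.≤ ⌊ n /2⌋ → k ℕ.* 2 ℕ.≤ n
k≤⌊n/2⌋⇒k*2≤n n             zero    _         = z≤n
k≤⌊n/2⌋⇒k*2≤n (suc (suc n)) (suc k) (s≤s k≤) = s≤s (s≤s (k≤⌊n/2⌋⇒k*2≤n n k k≤))

-- Writing the antidiagonal of f k j as k * 2 + j (not 2 * k + j) makes (suc k) * 2 reduce
-- to suc (suc (k * 2)), so shifting f by one row shifts α and β by two definitionally.
antidiagonal-recurrence : ∀ (α β : ℕ → ℚ) (f : ℕ → ℕ → ℚ) →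
  (∀ k → f (suc k) 0 ≡ β (k ℕ.* 2) * f k 0) →
  (∀ k j → f (suc k) (suc j) ≡ α (suc (k ℕ.* 2 ℕ.+ j)) * f (suc k) j + β (suc (k ℕ.* 2 ℕ.+ j)) * f k (suc j)) →
  ∀ n k → antidiagonal f (suc (suc n)) (suc k) ≡
          α n * antidiagonal f (suc n) (suc k) + β n * antidiagonal f n k
antidiagonal-recurrence α β f edge interior zero zero =
  trans (edge 0) (sym (trans (cong (_+ β 0 * f 0 0) (*-zeroʳ (α 0))) (+-identityˡ (β 0 * f 0 0))))
antidiagonal-recurrence α β f edge interior zero (suc k) =
  sym (cong₂ _+_ (*-zeroʳ (α 0)) (*-zeroʳ (β 0)))
antidiagonal-recurrence α β f edge interior (suc zero) zero = interior 0 0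
antidiagonal-recurrence α β f edge interior (suc zero) (suc k) =
  sym (cong₂ _+_ (*-zeroʳ (α 1)) (*-zeroʳ (β 1)))
antidiagonal-recurrence α β f edge interior (suc (suc n)) zero = interior 0 (suc n)
antidiagonal-recurrence α β f edge interior (suc (suc n)) (suc k) =
  antidiagonal-recurrence (λ n → α (suc (suc n))) (λ n → β (suc (suc n))) (λ k → f (suc k))
    (λ k → edge (suc k)) (λ k → interior (suc k)) n k

module _ (α β : ℕ → ℚ) (f : ℕ → ℕ → ℚ)
  (column   : ∀ j → f 0 (suc (suc j)) ≡ α j * f 0 (suc j))
  (edge     : ∀ k → f (suc k) 0 ≡ β (k ℕ.* 2) * f k 0)
  (interior : ∀ k j → f (suc k) (suc j) ≡ α (suc (k ℕ.* 2 ℕ.+ j)) * f (suc k) j + β (suc (k ℕ.* 2 ℕ.+ j)) * f k (suc j))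
  (u : ℕ → ℚ) (u₀ : u 0 ≡ f 0 0) (u₁ : u 1 ≡ f 0 1)
  (u-rec : ∀ n → u (suc (suc n)) ≡ α n * u (suc n) + β n * u n)
  where

  solution≡antidiagonal-sum : ∀ n N → ⌊ n /2⌋ ℕ.< N → u n ≡ sumTo N (antidiagonal f n)
  solution≡antidiagonal-sum zero (suc N) _ = begin
    u 0                                ≡⟨ u₀ ⟩
    f 0 0                              ≡⟨ sym (+-identityʳ (f 0 0)) ⟩
    f 0 0 + 0ℚ                         ≡⟨ cong (f 0 0 +_) (sym (sumTo-zero N (λ _ → 0ℚ) (λ _ → refl))) ⟩
    f 0 0 + sumTo N (λ _ → 0ℚ)         ≡⟨ sym (sumTo-suc N (antidiagonal f 0)) ⟩
    sumTo (suc N) (antidiagonal f 0)   ∎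
  solution≡antidiagonal-sum (suc zero) (suc N) _ = begin
    u 1                                ≡⟨ u₁ ⟩
    f 0 1                              ≡⟨ sym (+-identityʳ (f 0 1)) ⟩
    f 0 1 + 0ℚ                         ≡⟨ cong (f 0 1 +_) (sym (sumTo-zero N (λ _ → 0ℚ) (λ _ → refl))) ⟩
    f 0 1 + sumTo N (λ _ → 0ℚ)         ≡⟨ sym (sumTo-suc N (antidiagonal f 1)) ⟩
    sumTo (suc N) (antidiagonal f 1)   ∎
  solution≡antidiagonal-sum (suc (suc n)) (suc N) (s≤s ⌊n/2⌋<N) = begin
    u (suc (suc n))
      ≡⟨ u-rec n ⟩
    α n * u (suc n) + β n * u n
      ≡⟨ cong₂ (λ A B → α n * A + β n * B)
               (solution≡antidiagonal-sum (suc n) (suc N) (s≤s (ℕ.≤-trans (ℕ.⌊n/2⌋-mono (ℕ.n≤1+n (suc n))) ⌊n/2⌋<N)))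
               (solution≡antidiagonal-sum n N ⌊n/2⌋<N) ⟩
    α n * sumTo (suc N) (t (suc n)) + β n * sumTo N (t n)
      ≡⟨ cong (λ A → α n * A + β n * sumTo N (t n)) (sumTo-suc N (t (suc n))) ⟩
    α n * (f 0 (suc n) + sumTo N (λ k → t (suc n) (suc k))) + β n * sumTo N (t n)
      ≡⟨ regroup (α n) (β n) (f 0 (suc n)) _ _ ⟩
    α n * f 0 (suc n) + (α n * sumTo N (λ k → t (suc n) (suc k)) + β n * sumTo N (t n))
      ≡⟨ cong₂ _+_ (sym (column n)) (sym (sumTo-linear N (α n) (β n) _ (t n))) ⟩
    f 0 (suc (suc n)) + sumTo N (λ k → α n * t (suc n) (suc k) + β n * t n k)
      ≡⟨ cong (f 0 (suc (suc n)) +_)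
              (sumTo-cong N (λ k _ → sym (antidiagonal-recurrence α β f edge interior n k))) ⟩
    f 0 (suc (suc n)) + sumTo N (λ k → t (suc (suc n)) (suc k))
      ≡⟨ sym (sumTo-suc N (t (suc (suc n)))) ⟩
    sumTo (suc N) (t (suc (suc n)))
      ∎
    where
    t = antidiagonal f
    regroup : ∀ a b x S T → a * (x + S) + b * T ≡ a * x + (a * S + b * T)
    regroup = solve-∀ ℚ-ring

-- prodRange q k (k + j), indexed by its number j of factors.
prodAbove : ℚ → ℕ → ℕ → ℚ
prodAbove q k j = prodTo j (λ i → 1ℚ + q ^ (k ℕ.+ suc i))

prodAbove-suc : ∀ q k j → prodAbove q k (suc j) ≡ (1ℚ + q ^ suc k) * prodAbove q (suc k) j
prodAbove-suc q k j = trans (prodTo-suc j _)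
  (cong₂ _*_ (cong (λ m → 1ℚ + q ^ m) (ℕ.+-comm k 1))
             (prodTo-cong j (λ i → cong (λ m → 1ℚ + q ^ m) (ℕ.+-suc k (suc i)))))

module _ (q x s : ℚ) where

  entry : ℕ → ℕ → ℚ
  entry k j = q ^ (k ℕ.* k) * gauss q k j * prodAbove q k j * s ^ k * x ^ j

  α β : ℕ → ℚ
  α n = (1ℚ + q ^ suc (suc n)) * x
  β n = q ^ suc n * s

  entry-column : ∀ j → entry 0 (suc (suc j)) ≡ α j * entry 0 (suc j)
  entry-column j = regroup (prodAbove q 0 (suc j)) (q ^ suc (suc j)) x (x ^ suc j)
    where
    regroup : ∀ P c x X → 1ℚ * 1ℚ * (P * (1ℚ + c)) * 1ℚ * (x * X) ≡ (1ℚ + c) * x * (1ℚ * 1ℚ * P * 1ℚ * X)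
    regroup = solve-∀ ℚ-ring

  entry-edge : ∀ k → entry (suc k) 0 ≡ β (k ℕ.* 2) * entry k 0
  entry-edge k = begin
    q ^ (suc k ℕ.* suc k) * 1ℚ * 1ℚ * (s * S) * 1ℚ
      ≡⟨ cong (λ e → e * 1ℚ * 1ℚ * (s * S) * 1ℚ) (^-suc-square q k) ⟩
    K * (q * (r * r)) * 1ℚ * 1ℚ * (s * S) * 1ℚ
      ≡⟨ regroup K q r s S ⟩
    q * (r * r) * s * (K * 1ℚ * 1ℚ * S * 1ℚ)
      ≡⟨ cong₂ (λ r² g → q * r² * s * (K * g * 1ℚ * S * 1ℚ)) (sym (^-*2 q k)) (sym (gauss-zeroʳ q k)) ⟩
    β (k ℕ.* 2) * entry k 0
      ∎
    where
    K = q ^ (k ℕ.* k)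
    r = q ^ k
    S = s ^ k
    regroup : ∀ K q r s S → K * (q * (r * r)) * 1ℚ * 1ℚ * (s * S) * 1ℚ ≡ q * (r * r) * s * (K * 1ℚ * 1ℚ * S * 1ℚ)
    regroup = solve-∀ ℚ-ring

  entry-interior : ∀ k j → entry (suc k) (suc j) ≡
    α (suc (k ℕ.* 2 ℕ.+ j)) * entry (suc k) j + β (suc (k ℕ.* 2 ℕ.+ j)) * entry k (suc j)
  entry-interior k j = begin
    q ^ (suc k ℕ.* suc k) * g₁₁ * (P * (1ℚ + q ^ (suc k ℕ.+ suc j))) * (s * S) * (x * X)
      ≡⟨ cong₂ (λ K′ e → K′ * g₁₁ * (P * (1ℚ + e)) * (s * S) * (x * X)) (^-suc-square q k) (^-+ q (suc k) (suc j)) ⟩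
    K * (q * (r * r)) * g₁₁ * (P * (1ℚ + q * r * (q * t))) * (s * S) * (x * X)
      ≡⟨ factor K q r t P s S x X g₁₁ ⟩
    C * ((1ℚ + q * r * (q * t)) * g₁₁)
      ≡⟨ cong (C *_) (gauss-mixed q k j) ⟩
    C * ((1ℚ + q * r * (q * r) * (q * t)) * g₁₀ + q * t * (1ℚ + q * r) * g₀₁)
      ≡⟨ expand K q r t P s S x X g₁₀ g₀₁ ⟩
    (1ℚ + q * (q * (q * (r * r * t)))) * x * (K * (q * (r * r)) * g₁₀ * P * (s * S) * X)
      + q * (q * (r * r * t)) * s * (K * g₀₁ * ((1ℚ + q * r) * P) * S * (x * X))
      ≡⟨ cong₂ (λ e Pk → (1ℚ + q * (q * (q * e))) * x * (K * (q * (r * r)) * g₁₀ * P * (s * S) * X)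
                           + q * (q * e) * s * (K * g₀₁ * Pk * S * (x * X)))
               (sym (^-*2+ q k j)) (sym (prodAbove-suc q k j)) ⟩
    α (suc (k ℕ.* 2 ℕ.+ j)) * (K * (q * (r * r)) * g₁₀ * P * (s * S) * X) + β (suc (k ℕ.* 2 ℕ.+ j)) * entry k (suc j)
      ≡⟨ cong (λ K′ → α (suc (k ℕ.* 2 ℕ.+ j)) * (K′ * g₁₀ * P * (s * S) * X) + β (suc (k ℕ.* 2 ℕ.+ j)) * entry k (suc j))
              (sym (^-suc-square q k)) ⟩
    α (suc (k ℕ.* 2 ℕ.+ j)) * entry (suc k) j + β (suc (k ℕ.* 2 ℕ.+ j)) * entry k (suc j)
      ∎
    where
    K = q ^ (k ℕ.* k)
    r = q ^ k
    t = q ^ j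
    P = prodAbove q (suc k) j
    S = s ^ k
    X = x ^ j
    g₁₁ = gauss q (suc k) (suc j)
    g₁₀ = gauss q (suc k) j
    g₀₁ = gauss q k (suc j)
    C = K * (q * (r * r)) * P * (s * S) * (x * X)
    factor : ∀ K q r t P s S x X g →
      K * (q * (r * r)) * g * (P * (1ℚ + q * r * (q * t))) * (s * S) * (x * X) ≡
      K * (q * (r * r)) * P * (s * S) * (x * X) * ((1ℚ + q * r * (q * t)) * g)
    factor = solve-∀ ℚ-ring
    expand : ∀ K q r t P s S x X a b →
      K * (q * (r * r)) * P * (s * S) * (x * X) * ((1ℚ + q * r * (q * r) * (q * t)) * a + q * t * (1ℚ + q * r) * b) ≡
      (1ℚ + q * (q * (q * (r * r * t)))) * x * (K * (q * (r * r)) * a * P * (s * S) * X)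
        + q * (q * (r * r * t)) * s * (K * b * ((1ℚ + q * r) * P) * S * (x * X))
    expand = solve-∀ ℚ-ring

  U≡antidiagonal-sum : ∀ n N → ⌊ n /2⌋ ℕ.< N → U n x s q ≡ sumTo N (antidiagonal entry n)
  U≡antidiagonal-sum = solution≡antidiagonal-sum α β entry entry-column entry-edge entry-interior
    (λ n → U n x s q) refl (U₁ q x) (λ n → refl)
    where
    U₁ : ∀ q x → (1ℚ + q * 1ℚ) * x * 1ℚ ≡ 1ℚ * 1ℚ * (1ℚ * (1ℚ + q * 1ℚ)) * 1ℚ * (x * 1ℚ)
    U₁ = solve-∀ ℚ-ring

  rhs-term : ℕ → ℕ → ℚ
  rhs-term n k = (q ^ (k ℕ.* k)) * qbinom q (n ∸ k) k * prodRange q k (n ∸ k) * (s ^ k) * (x ^ (n ∸ (2 ℕ.* k)))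

  entry≡rhs-term : q ≢ - 1ℚ → ∀ k j → entry k j ≡ rhs-term (k ℕ.* 2 ℕ.+ j) k
  entry≡rhs-term q≢-1 k j = sym (begin
    rhs-term (k ℕ.* 2 ℕ.+ j) k
      ≡⟨ cong₂ (λ m m′ → q ^ (k ℕ.* k) * qbinom q m k * prodRange q k m * s ^ k * x ^ m′) drop-k drop-2k ⟩
    q ^ (k ℕ.* k) * qbinom q (k ℕ.+ j) k * prodRange q k (k ℕ.+ j) * s ^ k * x ^ j
      ≡⟨ cong₂ (λ g i → q ^ (k ℕ.* k) * g * prodTo i (λ i → 1ℚ + q ^ (k ℕ.+ suc i)) * s ^ k * x ^ j)
               (qbinom≡gauss q q≢-1 k j) (ℕ.m+n∸m≡n k j) ⟩
    entry k j
      ∎)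
    where
    k*2+j≡k+[k+j] : ∀ k j → k ℕ.* 2 ℕ.+ j ≡ k ℕ.+ (k ℕ.+ j)
    k*2+j≡k+[k+j] = ℕ-Solver.solve-∀
    drop-k : k ℕ.* 2 ℕ.+ j ∸ k ≡ k ℕ.+ j
    drop-k = trans (cong (_∸ k) (k*2+j≡k+[k+j] k j)) (ℕ.m+n∸m≡n k (k ℕ.+ j))
    drop-2k : k ℕ.* 2 ℕ.+ j ∸ 2 ℕ.* k ≡ j
    drop-2k = trans (cong (λ m → m ℕ.+ j ∸ 2 ℕ.* k) (ℕ.*-comm k 2)) (ℕ.m+n∸m≡n (2 ℕ.* k) j)

  antidiagonal-entry≡rhs-term : q ≢ - 1ℚ → ∀ n k → k ℕ.≤ ⌊ n /2⌋ → antidiagonal entry n k ≡ rhs-term n k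
  antidiagonal-entry≡rhs-term q≢-1 n k k≤⌊n/2⌋ =
    subst (λ m → antidiagonal entry m k ≡ rhs-term m k) (ℕ.m+[n∸m]≡n (k≤⌊n/2⌋⇒k*2≤n n k k≤⌊n/2⌋))
      (trans (antidiagonal-*2+ entry k j) (entry≡rhs-term q≢-1 k j))
    where j = n ∸ k ℕ.* 2

theorem2p3 : (q : ℚ) → q ≢ - 1ℚ → (x s : ℚ) → (n : ℕ) → U n x s q ≡ rhs n x s q
theorem2p3 q q≢-1 x s n = begin
  U n x s q
    ≡⟨ U≡antidiagonal-sum q x s n (suc ⌊ n /2⌋) (ℕ.n<1+n ⌊ n /2⌋) ⟩
  sumTo (suc ⌊ n /2⌋) (antidiagonal (entry q x s) n)
    ≡⟨ sumTo-cong (suc ⌊ n /2⌋) (λ k k<1+⌊n/2⌋ →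
         antidiagonal-entry≡rhs-term q x s q≢-1 n k (ℕ.≤-pred k<1+⌊n/2⌋)) ⟩
  rhs n x s q
    ∎
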